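{- There is a constant $f$ such that the following holds. Let $m$ be a power of $2$, $w_i=m/2^i$, and $i\ge0$ with $w_{i+1}\ge1$. Form layer $i+1$ of a random circuit as follows: for each $j\in[w_{i+1}]$, independently choose a multiset $S_{(i+1)j}$ of $f$ indices, each uniform in $[w_i]$ (sampled independently with replacement), and let gate $L_{(i+1)j}$ be $\mathrm{Thr}_{0.8}$ applied to the bits of layer $i$ indexed by $S_{(i+1)j}$. For $y\in\{0,1\}^{w_i}$ let $L_{i+1}(y)\in\{0,1\}^{w_{i+1}}$ be the vector of gate outputs on input $y$. Then $$\Pr\big[\forall y\in\{0,1\}^{w_i}\text{ with }\overline{y}\le 7/10:\ \overline{L_{i+1}(y)}\le 6/10\big]\ge 1-2^{ -m/2^i},$$ the probability being over the choice of the sets $S_{(i+1)j}$.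
   Context: For a bit string $x$, $\overline{x}$ denotes its fraction of ones. $\mathrm{Thr}_{\delta}$ applied to a collection (multiset) of bits outputs $1$ iff at least a $\delta$-fraction of them are $1$. -}

module Defs where

open import Data.Bool using (Bool; true; false; if_then_else_)
open import Data.Nat using (ℕ; zero; suc; _+_; _*_; _∸_; _^_; _≤ᵇ_)
open import Data.Fin using (Fin)
open import Data.List using (List; []; _∷_; map; concatMap; length; filterᵇ; allFin)
open import Data.Vec.Functional using () renaming (_∷_ to _◂_)

enumFun : {A : Set} → List A → (n : ℕ) → List (Fin n → A)
enumFun xs zero = (λ ()) ∷ []
enumFun xs (suc n) = concatMap (λ a → map (λ h → a ◂ h) (enumFun xs n)) xs

ones : (n : ℕ) → (Fin n → Bool) → ℕ
ones n y = length (filterᵇ y (allFin n))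

thr08 : (f : ℕ) → (Fin f → Bool) → Bool
thr08 f b = (8 * f) ≤ᵇ (10 * ones f b)

-- Layer width w_i = m / 2^i with m = 2^k.
width : (k i : ℕ) → ℕ
width k i = 2 ^ (k ∸ i)

allᵇ : {A : Set} → (A → Bool) → List A → Bool
allᵇ p [] = true
allᵇ p (x ∷ xs) = if p x then allᵇ p xs else false

-- A choice of the multisets S_{(i+1)j}: for each gate j ∈ [wOut], an f-tuple of
-- indices in [wIn] (sampled with replacement, ordered tuple = sample).
Choice : (f wIn wOut : ℕ) → Set
Choice f wIn wOut = Fin wOut → Fin f → Fin wIn

layer : (f wIn wOut : ℕ) → Choice f wIn wOut → (Fin wIn → Bool) → (Fin wOut → Bool)
layer f wIn wOut S y j = thr08 f (λ k → y (S j k))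

good : (f wIn wOut : ℕ) → Choice f wIn wOut → Bool
good f wIn wOut S =
  allᵇ (λ y → if (10 * ones wIn y) ≤ᵇ (7 * wIn)
             then (10 * ones wOut (layer f wIn wOut S y)) ≤ᵇ (6 * wOut)
             else true)
      (enumFun (true ∷ false ∷ []) wIn)

-- Full sample space of choices, each outcome equally likely.
allChoices : (f wIn wOut : ℕ) → List (Choice f wIn wOut)
allChoices f wIn wOut = enumFun (enumFun (allFin wIn) f) wOut

goodCount : (f wIn wOut : ℕ) → ℕ
goodCount f wIn wOut = length (filterᵇ (good f wIn wOut) (allChoices f wIn wOut))

totalCount : (f wIn wOut : ℕ) → ℕ
totalCount f wIn wOut = length (allChoices f wIn wOut)

-- Take f = 300, n = w_i = 2g and g = w_{i+1}, and fix an input y of density at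
-- most 7/10.  A gate reads 300 independent uniform bits of y, so Markov's
-- inequality for 2^(#ones read), whose mean is ((n + #ones y)/n)^300 ≤ (17/10)^300,
-- shows that it fires with probability at most 17^300 / (2^240 10^300) ≤ 2^(-10).
-- The g gates are independent, so the same argument for 1024^(#firing gates)
-- bounds the probability that at least 6/10 of them fire by
-- 2^(-6g) (1 + 1023 · 2^(-10))^g ≤ 2^(-5g) ≤ 2^(-2n).  A union bound over the
-- 2^n inputs y leaves a failure probability of at most 2^(-n).
module Submission where

open import Defs
open import Data.Bool using (Bool; true; false; if_then_else_; not; T)
open import Data.Empty using (⊥-elim)
open import Data.Fin using (Fin; zero; suc)
open import Data.List using (List; []; _∷_; map; concatMap; length; filterᵇ; allFin; tabulate)
open import Data.List.Properties using (length-++; length-map; length-tabulate; map-++; map-cong; map-∘; map-tabulate)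
open import Data.Nat
open import Data.Nat.ListAction using (sum)
open import Data.Nat.ListAction.Properties using (sum-++)
open import Data.Nat.Properties
open import Data.Nat.Solver using (module +-*-Solver)
open import Data.Product using (∃-syntax; _,_)
open import Data.Unit using (tt)
open import Data.Vec.Functional using () renaming (_∷_ to _◂_)
open import Function using (_∘_; id)
open import Relation.Binary.PropositionalEquality
open import Relation.Nullary using (¬_; Dec; yes; no)

open +-*-Solver

𝟙 : Bool → ℕ
𝟙 true = 1
𝟙 false = 0

count : {A : Set} → (A → Bool) → List A → ℕ
count p xs = length (filterᵇ p xs)

module _ {A : Set} where

  count-∷ : (p : A → Bool) (x : A) (xs : List A) → count p (x ∷ xs) ≡ 𝟙 (p x) + count p xs
  count-∷ p x xs with p x
  ... | true = refl
  ... | false = refl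

  count-≤-length : (p : A → Bool) (xs : List A) → count p xs ≤ length xs
  count-≤-length p [] = z≤n
  count-≤-length p (x ∷ xs) rewrite count-∷ p x xs with p x
  ... | true = s≤s (count-≤-length p xs)
  ... | false = m≤n⇒m≤1+n (count-≤-length p xs)

  count-not+count : (p : A → Bool) (xs : List A) → count (not ∘ p) xs + count p xs ≡ length xs
  count-not+count p [] = refl
  count-not+count p (x ∷ xs) rewrite count-∷ p x xs | count-∷ (not ∘ p) x xs with p x
  ... | true = trans (+-suc _ _) (cong suc (count-not+count p xs))
  ... | false = cong suc (count-not+count p xs)

  count-none : (p : A → Bool) (xs : List A) → (∀ x → p x ≡ false) → count p xs ≡ 0
  count-none p [] none = refl
  count-none p (x ∷ xs) none = trans (count-∷ p x xs) (cong₂ _+_ (cong 𝟙 (none x)) (count-none p xs none))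

  sum-map-const : (c : ℕ) (xs : List A) → sum (map (λ _ → c) xs) ≡ length xs * c
  sum-map-const c [] = refl
  sum-map-const c (x ∷ xs) = cong (c +_) (sum-map-const c xs)

  sum-map-+ : (F G : A → ℕ) (xs : List A) → sum (map (λ x → F x + G x) xs) ≡ sum (map F xs) + sum (map G xs)
  sum-map-+ F G [] = refl
  sum-map-+ F G (x ∷ xs) rewrite sum-map-+ F G xs =
    solve 4 (λ a b c d → (a :+ b) :+ (c :+ d) := (a :+ c) :+ (b :+ d)) refl
      (F x) (G x) (sum (map F xs)) (sum (map G xs))

  sum-map-*ˡ : (c : ℕ) (F : A → ℕ) (xs : List A) → sum (map (λ x → c * F x) xs) ≡ c * sum (map F xs)
  sum-map-*ˡ c F [] = sym (*-zeroʳ c)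
  sum-map-*ˡ c F (x ∷ xs) rewrite sum-map-*ˡ c F xs = sym (*-distribˡ-+ c (F x) (sum (map F xs)))

  sum-map-*ʳ : (c : ℕ) (F : A → ℕ) (xs : List A) → sum (map (λ x → F x * c) xs) ≡ sum (map F xs) * c
  sum-map-*ʳ c F [] = refl
  sum-map-*ʳ c F (x ∷ xs) rewrite sum-map-*ʳ c F xs = sym (*-distribʳ-+ c (F x) (sum (map F xs)))

  sum-map-*-≤ : (M c : ℕ) (F : A → ℕ) (xs : List A) → (∀ x → F x * M ≤ c) → sum (map F xs) * M ≤ length xs * c
  sum-map-*-≤ M c F [] bound = z≤n
  sum-map-*-≤ M c F (x ∷ xs) bound rewrite *-distribʳ-+ M (F x) (sum (map F xs)) =
    +-mono-≤ (bound x) (sum-map-*-≤ M c F xs bound)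

  count-*-≤-sum : (p : A → Bool) (F : A → ℕ) (B : ℕ) (xs : List A) →
                  (∀ x → p x ≡ true → B ≤ F x) → count p xs * B ≤ sum (map F xs)
  count-*-≤-sum p F B [] bound = z≤n
  count-*-≤-sum p F B (x ∷ xs) bound rewrite count-∷ p x xs with p x in px
  ... | true = +-mono-≤ (bound x px) (count-*-≤-sum p F B xs bound)
  ... | false = ≤-trans (count-*-≤-sum p F B xs bound) (m≤n+m _ _)

  sum-map-^𝟙 : (c : ℕ) (p : A → Bool) (xs : List A) →
               sum (map (λ x → c ^ 𝟙 (p x)) xs) ≡ count (not ∘ p) xs + c * count p xs
  sum-map-^𝟙 c p [] = sym (*-zeroʳ c)
  sum-map-^𝟙 c p (x ∷ xs) rewrite count-∷ p x xs | count-∷ (not ∘ p) x xs | sum-map-^𝟙 c p xs with p x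
  ... | true = solve 3 (λ c a b → c :* con 1 :+ (a :+ c :* b) := a :+ c :* (con 1 :+ b)) refl
                 c (count (not ∘ p) xs) (count p xs)
  ... | false = refl

module _ {A B : Set} where

  count-map : (p : B → Bool) (f : A → B) (xs : List A) → count p (map f xs) ≡ count (p ∘ f) xs
  count-map p f [] = refl
  count-map p f (x ∷ xs) = trans (count-∷ p (f x) (map f xs))
    (trans (cong (𝟙 (p (f x)) +_) (count-map p f xs)) (sym (count-∷ (p ∘ f) x xs)))

  sum-concatMap : (F : B → ℕ) (g : A → List B) (xs : List A) →
                  sum (map F (concatMap g xs)) ≡ sum (map (λ x → sum (map F (g x))) xs)
  sum-concatMap F g [] = refl
  sum-concatMap F g (x ∷ xs) rewrite map-++ F (g x) (concatMap g xs) | sum-++ (map F (g x)) (map F (concatMap g xs)) =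
    cong (sum (map F (g x)) +_) (sum-concatMap F g xs)

  length-concatMap : (g : A → List B) (xs : List A) → length (concatMap g xs) ≡ sum (map (λ x → length (g x)) xs)
  length-concatMap g [] = refl
  length-concatMap g (x ∷ xs) rewrite length-++ (g x) {concatMap g xs} =
    cong (length (g x) +_) (length-concatMap g xs)

count-notAll≤sum-count : {A Y : Set} (Q : A → Y → Bool) (ys : List Y) (xs : List A) →
  count (λ x → not (allᵇ (Q x) ys)) xs ≤ sum (map (λ y → count (λ x → not (Q x y)) xs) ys)
count-notAll≤sum-count Q ys [] = ≤-reflexive (sym (trans (sum-map-const 0 ys) (*-zeroʳ (length ys))))
count-notAll≤sum-count Q ys (x ∷ xs) = begin
    count (λ x → not (allᵇ (Q x) ys)) (x ∷ xs)
  ≡⟨ count-∷ (λ x → not (allᵇ (Q x) ys)) x xs ⟩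
    𝟙 (not (allᵇ (Q x) ys)) + count (λ x → not (allᵇ (Q x) ys)) xs
  ≤⟨ +-mono-≤ (𝟙-notAll≤sum (Q x) ys) (count-notAll≤sum-count Q ys xs) ⟩
    sum (map (λ y → 𝟙 (not (Q x y))) ys) + sum (map (λ y → count (λ x → not (Q x y)) xs) ys)
  ≡⟨ sym (sum-map-+ (λ y → 𝟙 (not (Q x y))) (λ y → count (λ x → not (Q x y)) xs) ys) ⟩
    sum (map (λ y → 𝟙 (not (Q x y)) + count (λ x → not (Q x y)) xs) ys)
  ≡⟨ cong sum (map-cong (λ y → sym (count-∷ (λ x → not (Q x y)) x xs)) ys) ⟩
    sum (map (λ y → count (λ x → not (Q x y)) (x ∷ xs)) ys) ∎
  where
    open ≤-Reasoning
    𝟙-notAll≤sum : ∀ {Y} (q : Y → Bool) (ys : List Y) → 𝟙 (not (allᵇ q ys)) ≤ sum (map (λ y → 𝟙 (not (q y))) ys)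
    𝟙-notAll≤sum q [] = z≤n
    𝟙-notAll≤sum q (y ∷ ys) with q y
    ... | true = 𝟙-notAll≤sum q ys
    ... | false = s≤s z≤n

length-enumFun : {A : Set} (xs : List A) (m : ℕ) → length (enumFun xs m) ≡ length xs ^ m
length-enumFun xs zero = refl
length-enumFun xs (suc m) = begin
    length (concatMap (λ a → map (a ◂_) (enumFun xs m)) xs)
  ≡⟨ length-concatMap _ xs ⟩
    sum (map (λ a → length (map (a ◂_) (enumFun xs m))) xs)
  ≡⟨ cong sum (map-cong (λ a → length-map (a ◂_) (enumFun xs m)) xs) ⟩
    sum (map (λ _ → length (enumFun xs m)) xs)
  ≡⟨ sum-map-const _ xs ⟩
    length xs * length (enumFun xs m)
  ≡⟨ cong (length xs *_) (length-enumFun xs m) ⟩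
    length xs * length xs ^ m ∎
  where open ≡-Reasoning

ones-suc : (m : ℕ) (y : Fin (suc m) → Bool) → ones (suc m) y ≡ 𝟙 (y zero) + ones m (y ∘ suc)
ones-suc m y = trans (count-∷ y zero (tabulate suc))
  (cong (𝟙 (y zero) +_) (trans (cong (count y) (sym (map-tabulate id suc))) (count-map y suc (allFin m))))

-- The coordinates of a uniformly chosen h are independent, so E[c^(#i. p (h i))] factorises.
sum-enumFun-^-ones : {A : Set} (c : ℕ) (p : A → Bool) (xs : List A) (m : ℕ) →
  sum (map (λ h → c ^ ones m (p ∘ h)) (enumFun xs m)) ≡ sum (map (λ x → c ^ 𝟙 (p x)) xs) ^ m
sum-enumFun-^-ones c p xs zero = refl
sum-enumFun-^-ones c p xs (suc m) = begin
    sum (map F (concatMap (λ a → map (a ◂_) H) xs))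
  ≡⟨ sum-concatMap F _ xs ⟩
    sum (map (λ a → sum (map F (map (a ◂_) H))) xs)
  ≡⟨ cong sum (map-cong extend xs) ⟩
    sum (map (λ a → c ^ 𝟙 (p a) * S) xs)
  ≡⟨ sum-map-*ʳ S (λ a → c ^ 𝟙 (p a)) xs ⟩
    sum (map (λ a → c ^ 𝟙 (p a)) xs) * S
  ≡⟨ cong (sum (map (λ a → c ^ 𝟙 (p a)) xs) *_) (sum-enumFun-^-ones c p xs m) ⟩
    sum (map (λ a → c ^ 𝟙 (p a)) xs) ^ suc m ∎
  where
    open ≡-Reasoning
    H = enumFun xs m
    F : (Fin (suc m) → _) → ℕ
    F h = c ^ ones (suc m) (p ∘ h)
    S = sum (map (λ h → c ^ ones m (p ∘ h)) H)
    extend : ∀ a → sum (map F (map (a ◂_) H)) ≡ c ^ 𝟙 (p a) * S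
    extend a = begin
        sum (map F (map (a ◂_) H))
      ≡⟨ cong sum (sym (map-∘ H)) ⟩
        sum (map (λ h → F (a ◂ h)) H)
      ≡⟨ cong sum (map-cong (λ h → trans (cong (c ^_) (ones-suc m (p ∘ (a ◂ h)))) (^-distribˡ-+-* c (𝟙 (p a)) _)) H) ⟩
        sum (map (λ h → c ^ 𝟙 (p a) * c ^ ones m (p ∘ h)) H)
      ≡⟨ sum-map-*ˡ (c ^ 𝟙 (p a)) (λ h → c ^ ones m (p ∘ h)) H ⟩
        c ^ 𝟙 (p a) * S ∎

count-enumFun-*-≤ : {A : Set} (c B : ℕ) (p : A → Bool) (xs : List A) (m : ℕ) (q : (Fin m → A) → Bool) →
  (∀ h → q h ≡ true → B ≤ c ^ ones m (p ∘ h)) →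
  count q (enumFun xs m) * B ≤ (count (not ∘ p) xs + c * count p xs) ^ m
count-enumFun-*-≤ c B p xs m q bound = begin
    count q (enumFun xs m) * B
  ≤⟨ count-*-≤-sum q (λ h → c ^ ones m (p ∘ h)) B (enumFun xs m) bound ⟩
    sum (map (λ h → c ^ ones m (p ∘ h)) (enumFun xs m))
  ≡⟨ sum-enumFun-^-ones c p xs m ⟩
    sum (map (λ x → c ^ 𝟙 (p x)) xs) ^ m
  ≡⟨ cong (_^ m) (sum-map-^𝟙 c p xs) ⟩
    (count (not ∘ p) xs + c * count p xs) ^ m ∎
  where open ≤-Reasoning

*-^-distrib : ∀ a b m → (a * b) ^ m ≡ a ^ m * b ^ m
*-^-distrib a b zero = refl
*-^-distrib a b (suc m) rewrite *-^-distrib a b m =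
  solve 4 (λ a b x y → (a :* b) :* (x :* y) := (a :* x) :* (b :* y)) refl a b (a ^ m) (b ^ m)

≤ᵇ≡false⇒> : ∀ a b → (a ≤ᵇ b) ≡ false → b < a
≤ᵇ≡false⇒> a b eq with a ≤? b
... | yes a≤b = ⊥-elim (subst T eq (≤⇒≤ᵇ a≤b))
... | no a≰b = ≰⇒> a≰b

≰⇒≤ᵇ≡false : ∀ a b → ¬ (a ≤ b) → (a ≤ᵇ b) ≡ false
≰⇒≤ᵇ≡false a b a≰b with a ≤ᵇ b in eq
... | true = ⊥-elim (a≰b (≤ᵇ⇒≤ a b (subst T (sym eq) tt)))
... | false = refl

-- Probability 1 - 1/K of the good event, from K · #bad ≤ #bad + #good.
∸1-*-≤ : ∀ K b g → K * b ≤ b + g → (K ∸ 1) * (b + g) ≤ K * g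
∸1-*-≤ K b g Kb≤b+g = begin
    (K ∸ 1) * (b + g)
  ≡⟨ trans (*-distribʳ-∸ (b + g) K 1) (cong (K * (b + g) ∸_) (*-identityˡ (b + g))) ⟩
    K * (b + g) ∸ (b + g)
  ≤⟨ ∸-monoʳ-≤ (K * (b + g)) Kb≤b+g ⟩
    K * (b + g) ∸ K * b
  ≡⟨ cong (_∸ K * b) (*-distribˡ-+ K b g) ⟩
    K * b + K * g ∸ K * b
  ≡⟨ m+n∸m≡n (K * b) (K * g) ⟩
    K * g ∎
  where open ≤-Reasoning

Light : (n : ℕ) → (Fin n → Bool) → Set
Light n y = 10 * ones n y ≤ 7 * n

tuples : (n : ℕ) → List (Fin 300 → Fin n)
tuples n = enumFun (allFin n) 300

length-tuples : ∀ n → length (tuples n) ≡ n ^ 300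
length-tuples n = trans (length-enumFun (allFin n) 300) (cong (_^ 300) (length-tabulate {n = n} id))

fires : (n : ℕ) → (Fin n → Bool) → (Fin 300 → Fin n) → Bool
fires n y t = thr08 300 (y ∘ t)

1024*count-fires≤ : ∀ n (y : Fin n → Bool) → Light n y → 1024 * count (fires n y) (tuples n) ≤ n ^ 300
1024*count-fires≤ n y light = *-cancelʳ-≤ _ _ K {{>-nonZero (≤ᵇ⇒≤ 1 K tt)}} (begin
    1024 * N * K
  ≡⟨ solve 4 (λ c h x y → c :* h :* (x :* y) := c :* (h :* x :* y)) refl 1024 N (2 ^ 240) (10 ^ 300) ⟩
    1024 * (N * 2 ^ 240 * 10 ^ 300)
  ≤⟨ *-monoʳ-≤ 1024 (*-monoˡ-≤ (10 ^ 300) moment) ⟩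
    1024 * ((b + 2 * a) ^ 300 * 10 ^ 300)
  ≡⟨ cong (1024 *_) (trans (*-comm ((b + 2 * a) ^ 300) (10 ^ 300)) (sym (*-^-distrib 10 (b + 2 * a) 300))) ⟩
    1024 * (10 * (b + 2 * a)) ^ 300
  ≤⟨ *-monoʳ-≤ 1024 (^-monoˡ-≤ 300 mean) ⟩
    1024 * (17 * n) ^ 300
  ≡⟨ trans (cong (1024 *_) (*-^-distrib 17 n 300)) (sym (*-assoc 1024 (17 ^ 300) (n ^ 300))) ⟩
    1024 * 17 ^ 300 * n ^ 300
  ≤⟨ *-monoˡ-≤ (n ^ 300) (≤ᵇ⇒≤ (1024 * 17 ^ 300) K tt) ⟩
    K * n ^ 300
  ≡⟨ *-comm K (n ^ 300) ⟩
    n ^ 300 * K ∎)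
  where
    open ≤-Reasoning
    N = count (fires n y) (tuples n)
    a = ones n y
    b = count (not ∘ y) (allFin n)
    K = 2 ^ 240 * 10 ^ 300
    moment : N * 2 ^ 240 ≤ (b + 2 * a) ^ 300
    moment = count-enumFun-*-≤ 2 (2 ^ 240) y (allFin n) 300 (fires n y)
      (λ t fire → ^-monoʳ-≤ 2 (*-cancelˡ-≤ {240} {ones 300 (y ∘ t)} 10 (≤ᵇ⇒≤ 2400 _ (subst T (sym fire) tt))))
    mean : 10 * (b + 2 * a) ≤ 17 * n
    mean = begin
        10 * (b + 2 * a)
      ≡⟨ solve 2 (λ b a → con 10 :* (b :+ con 2 :* a) := con 10 :* (b :+ a) :+ con 10 :* a) refl b a ⟩
        10 * (b + a) + 10 * a
      ≤⟨ +-monoʳ-≤ (10 * (b + a)) light ⟩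
        10 * (b + a) + 7 * n
      ≡⟨ cong (λ z → 10 * z + 7 * n) (trans (count-not+count y (allFin n)) (length-tabulate {n = n} id)) ⟩
        10 * n + 7 * n
      ≡⟨ solve 1 (λ n → con 10 :* n :+ con 7 :* n := con 17 :* n) refl n ⟩
        17 * n ∎

count-heavy-layer*≤ : ∀ g (y : Fin (2 * g) → Bool) → Light (2 * g) y → (q : Choice 300 (2 * g) g → Bool) →
  (∀ S → q S ≡ true → 6 * g ≤ 10 * ones g (layer 300 (2 * g) g S y)) →
  count q (allChoices 300 (2 * g) g) * 2 ^ (4 * g) ≤ ((2 * g) ^ 300) ^ g
count-heavy-layer*≤ g y light q heavy = *-cancelʳ-≤ _ _ (2 ^ g) {{m^n≢0 2 g}} (begin
    N * 2 ^ (4 * g) * 2 ^ g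
  ≡⟨ trans (*-assoc N _ _) (cong (N *_) (sym (^-distribˡ-+-* 2 (4 * g) g))) ⟩
    N * 2 ^ (4 * g + g)
  ≤⟨ *-monoʳ-≤ N (^-monoʳ-≤ 2 (≤-trans (≤-reflexive (solve 1 (λ g → con 4 :* g :+ g := con 5 :* g) refl g)) (*-monoˡ-≤ g (≤ᵇ⇒≤ 5 6 tt)))) ⟩
    N * 2 ^ (6 * g)
  ≤⟨ moment ⟩
    (b + 1024 * h) ^ g
  ≤⟨ ^-monoˡ-≤ g (+-mono-≤ b≤n^300 (1024*count-fires≤ n y light)) ⟩
    (n ^ 300 + n ^ 300) ^ g
  ≡⟨ trans (cong (_^ g) (solve 1 (λ x → x :+ x := con 2 :* x) refl (n ^ 300))) (*-^-distrib 2 (n ^ 300) g) ⟩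
    2 ^ g * (n ^ 300) ^ g
  ≡⟨ *-comm (2 ^ g) _ ⟩
    (n ^ 300) ^ g * 2 ^ g ∎)
  where
    open ≤-Reasoning
    n = 2 * g
    N = count q (allChoices 300 n g)
    b = count (not ∘ fires n y) (tuples n)
    h = count (fires n y) (tuples n)
    b≤n^300 : b ≤ n ^ 300
    b≤n^300 = ≤-trans (count-≤-length _ (tuples n)) (≤-reflexive (length-tuples n))
    moment : N * 2 ^ (6 * g) ≤ (b + 1024 * h) ^ g
    moment = count-enumFun-*-≤ 1024 (2 ^ (6 * g)) (fires n y) (tuples n) g q
      (λ S qS → ≤-trans (^-monoʳ-≤ 2 (heavy S qS)) (≤-reflexive (sym (^-*-assoc 2 10 (ones g (fires n y ∘ S))))))

goodOn : (f wIn wOut : ℕ) → Choice f wIn wOut → (Fin wIn → Bool) → Bool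
goodOn f wIn wOut S y =
  if 10 * ones wIn y ≤ᵇ 7 * wIn then 10 * ones wOut (layer f wIn wOut S y) ≤ᵇ 6 * wOut else true

not-if-else-true : ∀ l o → not (if l then o else true) ≡ true → o ≡ false
not-if-else-true true false _ = refl

count-not-goodOn*≤ : ∀ g (y : Fin (2 * g) → Bool) →
  count (λ S → not (goodOn 300 (2 * g) g S y)) (allChoices 300 (2 * g) g) * 2 ^ (4 * g) ≤ ((2 * g) ^ 300) ^ g
count-not-goodOn*≤ g y = bound (10 * ones n y ≤? 7 * n)
  where
    n = 2 * g
    light? = 10 * ones n y ≤ᵇ 7 * n
    bad : Choice 300 n g → Bool
    bad S = not (goodOn 300 n g S y)
    bound : Dec (Light n y) → count bad (allChoices 300 n g) * 2 ^ (4 * g) ≤ (n ^ 300) ^ g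
    bound (yes light) = count-heavy-layer*≤ g y light bad (λ S badS →
      <⇒≤ (≤ᵇ≡false⇒> (10 * ones g (layer 300 n g S y)) (6 * g)
             (not-if-else-true light? (10 * ones g (layer 300 n g S y) ≤ᵇ 6 * g) badS)))
    bound (no heavy) = ≤-trans (≤-reflexive (cong (_* 2 ^ (4 * g)) (count-none bad (allChoices 300 n g) (λ S →
      cong (λ l → not (if l then 10 * ones g (layer 300 n g S y) ≤ᵇ 6 * g else true)) (≰⇒≤ᵇ≡false _ _ heavy))))) z≤n

goodCount-bound : ∀ g → (2 ^ (2 * g) ∸ 1) * totalCount 300 (2 * g) g ≤ 2 ^ (2 * g) * goodCount 300 (2 * g) g
goodCount-bound g = subst (λ t → (K ∸ 1) * t ≤ K * G) (count-not+count (good 300 n g) choices)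
  (∸1-*-≤ K bad G (*-cancelʳ-≤ (K * bad) (bad + G) K {{m^n≢0 2 n}} (begin
    K * bad * K
  ≡⟨ solve 2 (λ k b → k :* b :* k := b :* (k :* k)) refl K bad ⟩
    bad * (K * K)
  ≡⟨ cong (bad *_) (trans (sym (^-distribˡ-+-* 2 n n)) (cong (2 ^_) (solve 1 (λ g → con 2 :* g :+ con 2 :* g := con 4 :* g) refl g))) ⟩
    bad * 2 ^ (4 * g)
  ≤⟨ *-monoˡ-≤ (2 ^ (4 * g)) (count-notAll≤sum-count (goodOn 300 n g) inputs choices) ⟩
    sum (map (λ y → count (λ S → not (goodOn 300 n g S y)) choices) inputs) * 2 ^ (4 * g)
  ≤⟨ sum-map-*-≤ (2 ^ (4 * g)) _ _ inputs (count-not-goodOn*≤ g) ⟩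
    length inputs * (n ^ 300) ^ g
  ≡⟨ cong₂ _*_ (length-enumFun (true ∷ false ∷ []) n) (sym (trans (length-enumFun (tuples n) g) (cong (_^ g) (length-tuples n)))) ⟩
    K * length choices
  ≡⟨ trans (*-comm K _) (cong (_* K) (sym (count-not+count (good 300 n g) choices))) ⟩
    (bad + G) * K ∎)))
  where
    open ≤-Reasoning
    n = 2 * g
    K = 2 ^ n
    inputs = enumFun (true ∷ false ∷ []) n
    choices = allChoices 300 n g
    bad = count (not ∘ good 300 n g) choices
    G = goodCount 300 n g

lemma6 : ∃[ f ] ((k i : ℕ) → suc i ≤ k →
           (2 ^ width k i ∸ 1) * totalCount f (width k i) (width k (suc i))
             ≤ 2 ^ width k i * goodCount f (width k i) (width k (suc i)))
lemma6 = 300 , λ k i i<k →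
  subst (λ e → (2 ^ 2 ^ e ∸ 1) * totalCount 300 (2 ^ e) (width k (suc i))
                 ≤ 2 ^ 2 ^ e * goodCount 300 (2 ^ e) (width k (suc i)))
        (sym (+-∸-assoc 1 i<k))
        (goodCount-bound (width k (suc i)))
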